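{- Let $k\ge1$ be odd and let $d\geq k$ be an integer. Let $L_1,\dots,L_d$ be indeterminates and let $$N_d(z)=(1-z)^d+\sum_{i=1}^d L_i\,\phi_i(z)(1-z)^{d-i},$$ so that the coefficient $h^*_{d-1}$ of $z^{d-1}$ in $N_d(z)$ is an affine-linear expression in $L_1,\dots,L_d$. Then the coefficient of $L_k$ in $h^*_{d-1}$ is $$(-1)^{d+1}\big(a_{k,k-1}-(d-k)\big)=(-1)^{d+1}(2^k-1-d).$$
   Context: The $i$-th Euler polynomial $\phi_i(z)$ is defined by $\left(z\frac{d}{dz}\right)^i\frac{1}{1-z}=\frac{\phi_i(z)}{(1-z)^{i+1}}$, and $\phi_i(z)=\sum_{j=0}^i a_{i,j}z^j$ where $a_{i,j}$ are the Eulerian numbers. For a $d$-dimensional lattice polytope $\mathcal{P}$ with Ehrhart polynomial $1+L_1t+\dots+L_dt^d$, one has $\sum_{t\ge0}L_{\mathcal{P}}(t)z^t=N_d(z)/(1-z)^{d+1}$, and the coefficients of $N_d(z)=h^*_0+h^*_1z+\dots+h^*_dz^d$ form the $h^*$-vector of $\mathcal{P}$. -}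

module Defs where

open import Data.Nat as ℕ using (ℕ; zero; suc; _∸_)
open import Data.Integer as ℤ using (ℤ; +_; _+_; _*_; -_)
open import Data.List using (List; []; _∷_; map; take; foldr)
open import Data.List.Base using (upTo)
open import Data.Fin using (Fin)
open import Relation.Binary.PropositionalEquality using (_≡_)
open import Relation.Nullary using (Dec; yes; no)
open import Data.Fin using (_≟_)

-- Polynomials in z with integer coefficients, as coefficient lists
-- (constant term first).

Poly : Set
Poly = List ℤ

infixl 6 _⊕_
_⊕_ : Poly → Poly → Poly
[]      ⊕ q       = q
(a ∷ p) ⊕ []      = a ∷ p
(a ∷ p) ⊕ (b ∷ q) = (a + b) ∷ (p ⊕ q)

infixl 7 _⊗_
_⊗_ : Poly → Poly → Poly
[]      ⊗ q = []
(a ∷ p) ⊗ q = map (a *_) q ⊕ (+ 0 ∷ (p ⊗ q))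

coeff : ℕ → Poly → ℤ
coeff j       []      = + 0
coeff zero    (a ∷ p) = a
coeff (suc j) (a ∷ p) = coeff j p

one : Poly
one = + 1 ∷ []

oneMinusZ : Poly
oneMinusZ = + 1 ∷ ℤ.-[1+ 0 ] ∷ []

_^ᵖ_ : Poly → ℕ → Poly
p ^ᵖ zero  = one
p ^ᵖ suc n = p ⊗ (p ^ᵖ n)

-- Euler polynomials.
-- (z d/dz)^i 1/(1-z) is the formal power series  Σ_{n≥0} n^i z^n,
-- hence φ_i(z) = (1-z)^{i+1} Σ_{n≥0} n^i z^n, a polynomial of degree ≤ i.
-- Its coefficients of z^0..z^i only involve the series terms n ≤ i, so
-- φ_i = first i+1 coefficients of (1-z)^{i+1} · Σ_{n=0}^{i} n^i z^n.
-- (Convention 0^0 = 1, so φ_0 = 1.)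

seriesTrunc : ℕ → Poly
seriesTrunc i = map (λ n → + (n ℕ.^ i)) (upTo (suc i))

φ : ℕ → Poly
φ i = take (suc i) ((oneMinusZ ^ᵖ suc i) ⊗ seriesTrunc i)

a : ℕ → ℕ → ℤ
a i j = coeff j (φ i)

-- Polynomials in z whose coefficients are affine-linear forms in the
-- indeterminates L_1..L_d.  A form is a function Fin (suc d) → ℤ:
-- index zero = constant term, index (suc i) = coefficient of L_{i+1}.

Form : ℕ → Set
Form d = Fin (suc d) → ℤ

PolyL : ℕ → Set
PolyL d = List (Form d)

_⊕ᴸ_ : ∀ {d} → PolyL d → PolyL d → PolyL d
[]      ⊕ᴸ q       = q
(u ∷ p) ⊕ᴸ []      = u ∷ p
(u ∷ p) ⊕ᴸ (v ∷ q) = (λ l → u l + v l) ∷ (p ⊕ᴸ q)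

_·ᴸ_ : ∀ {d} → Poly → Form d → PolyL d
p ·ᴸ v = map (λ c l → c * v l) p

unitForm : ∀ {d} → Fin (suc d) → Form d
unitForm i l with i ≟ l
... | yes _ = + 1
... | no  _ = + 0

coeffL : ∀ {d} → ℕ → PolyL d → Form d
coeffL j       []      = λ _ → + 0
coeffL zero    (u ∷ p) = u
coeffL (suc j) (u ∷ p) = coeffL j p

sumTerms : (d : ℕ) → (m : ℕ) → (Fin m → Fin d) → PolyL d
sumTerms d zero    ι = []
sumTerms d (suc m) ι =
  sumTerms d m (λ i → ι (Fin.inject₁ i)) ⊕ᴸ
  ((φ (suc m) ⊗ (oneMinusZ ^ᵖ (d ∸ suc m))) ·ᴸ unitForm (Fin.suc (ι (Fin.fromℕ m))))
  where import Data.Fin as Fin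

N : (d : ℕ) → PolyL d
N d = ((oneMinusZ ^ᵖ d) ·ᴸ unitForm Fin.zero) ⊕ᴸ sumTerms d d (λ i → i)
  where import Data.Fin as Fin

hstar : (d j : ℕ) → Form d
hstar d j = coeffL j (N d)

-- Only the summand L_k φ_k(z) (1-z)^m of N_d, with m = d - k, involves L_k.  As φ_k
-- has degree k and leading coefficient a_{k,k} = 1, its coefficient of z^(d-1) is
-- a_{k,k-1} (-1)^m + (-1)^(m-1) m = (-1)^m (a_{k,k-1} - m), and (-1)^m = (-1)^(d+1)
-- for odd k.  The Eulerian numbers a_{k,j} are the (k+1)-fold backward differences
-- of n ↦ n^k at j, and the rule Δ^(r+1)(n s_n) = n Δ^(r+1) s_n + (r+1) Δ^r s_(n-1)
-- yields a_{k,k} = 1 and a_{k,k-1} = 2^k - 1 - k by induction on k.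

module Submission where

open import Defs
open import Data.Nat as ℕ using (ℕ; zero; suc; _≤_; _<_; z≤n; s≤s; _∸_; _%_) renaming (_^_ to _^ℕ_)
import Data.Nat.Properties as ℕₚ
open import Data.Nat.DivMod using (_/_; m≡m%n+[m/n]*n)
open import Data.Integer using (ℤ; +_; _+_; _*_; _-_; -[1+_]; -1ℤ; _^_)
import Data.Integer.Properties as ℤₚ
open import Data.Integer.Tactic.RingSolver using (solve-∀)
open import Data.Fin as Fin using (Fin; toℕ; fromℕ; fromℕ<; inject₁)
import Data.Fin.Properties as Finₚ
open import Data.List using ([]; _∷_; map; take; applyUpTo)
open import Data.Product using (_×_; _,_; ∃)
open import Data.Sum using (inj₁; inj₂)
open import Function using (_∘_; id)
open import Relation.Nullary using (yes; no; contradiction)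
open import Relation.Binary.PropositionalEquality
open ≡-Reasoning

-- A sequence f stands for the power series Σ f n zⁿ; shift and Δ are
-- multiplication by z and by 1 - z.

Seq : Set
Seq = ℕ → ℤ

⟦_⟧ : Poly → Seq
⟦ p ⟧ n = coeff n p

shift : Seq → Seq
shift f zero    = + 0
shift f (suc n) = f n

Δ : Seq → Seq
Δ f zero    = f zero
Δ f (suc n) = f (suc n) - f n

Δ^ : ℕ → Seq → Seq
Δ^ zero    f = f
Δ^ (suc r) f = Δ (Δ^ r f)

shift-cong : ∀ {f g} → f ≗ g → shift f ≗ shift g
shift-cong f≗g zero    = refl
shift-cong f≗g (suc n) = f≗g n

shift-zero : shift (λ _ → + 0) ≗ (λ _ → + 0)
shift-zero zero    = refl
shift-zero (suc n) = refl

shift-+ : ∀ f g → shift (λ n → f n + g n) ≗ (λ n → shift f n + shift g n)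
shift-+ f g zero    = refl
shift-+ f g (suc n) = refl

shift-* : ∀ c f → shift (λ n → c * f n) ≗ (λ n → c * shift f n)
shift-* c f zero    = sym (ℤₚ.*-zeroʳ c)
shift-* c f (suc n) = refl

Δ≡id-shift : ∀ f n → Δ f n ≡ f n - shift f n
Δ≡id-shift f zero    = sym (ℤₚ.+-identityʳ (f zero))
Δ≡id-shift f (suc n) = refl

Δ-cong : ∀ {f g} → f ≗ g → Δ f ≗ Δ g
Δ-cong f≗g zero    = f≗g zero
Δ-cong f≗g (suc n) = cong₂ _-_ (f≗g (suc n)) (f≗g n)

Δ^-local : ∀ r {f g} j → (∀ i → i ≤ j → f i ≡ g i) → Δ^ r f j ≡ Δ^ r g j
Δ^-local zero    j       f≡g = f≡g j ℕₚ.≤-refl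
Δ^-local (suc r) zero    f≡g = Δ^-local r zero f≡g
Δ^-local (suc r) (suc j) f≡g =
  cong₂ _-_ (Δ^-local r (suc j) f≡g) (Δ^-local r j (λ i i≤j → f≡g i (ℕₚ.m≤n⇒m≤1+n i≤j)))

coeff-⊕ : ∀ p q n → coeff n (p ⊕ q) ≡ coeff n p + coeff n q
coeff-⊕ []      q       n       = sym (ℤₚ.+-identityˡ _)
coeff-⊕ (x ∷ p) []      n       = sym (ℤₚ.+-identityʳ _)
coeff-⊕ (x ∷ p) (y ∷ q) zero    = refl
coeff-⊕ (x ∷ p) (y ∷ q) (suc n) = coeff-⊕ p q n

coeff-scale : ∀ c p n → coeff n (map (c *_) p) ≡ c * coeff n p
coeff-scale c []      n       = sym (ℤₚ.*-zeroʳ c)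
coeff-scale c (x ∷ p) zero    = refl
coeff-scale c (x ∷ p) (suc n) = coeff-scale c p n

coeff-∷⊗ : ∀ x p t n → coeff n ((x ∷ p) ⊗ t) ≡ x * coeff n t + shift ⟦ p ⊗ t ⟧ n
coeff-∷⊗ x p t n = trans (coeff-⊕ (map (x *_) t) (+ 0 ∷ (p ⊗ t)) n)
                         (cong₂ _+_ (coeff-scale x t n) (coeff-0∷ n))
  where
  coeff-0∷ : ∀ n → coeff n (+ 0 ∷ (p ⊗ t)) ≡ shift ⟦ p ⊗ t ⟧ n
  coeff-0∷ zero    = refl
  coeff-0∷ (suc n) = refl

coeff-[x]⊗ : ∀ x t n → coeff n ((x ∷ []) ⊗ t) ≡ x * coeff n t
coeff-[x]⊗ x t n = begin
  coeff n ((x ∷ []) ⊗ t)         ≡⟨ coeff-∷⊗ x [] t n ⟩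
  x * coeff n t + shift ⟦ [] ⟧ n ≡⟨ cong (_+_ (x * coeff n t)) (shift-zero n) ⟩
  x * coeff n t + + 0            ≡⟨ ℤₚ.+-identityʳ _ ⟩
  x * coeff n t                  ∎

coeff-⊕⊗ : ∀ p q t n → coeff n ((p ⊕ q) ⊗ t) ≡ coeff n (p ⊗ t) + coeff n (q ⊗ t)
coeff-⊕⊗ []      q       t n = sym (ℤₚ.+-identityˡ _)
coeff-⊕⊗ (x ∷ p) []      t n = sym (ℤₚ.+-identityʳ _)
coeff-⊕⊗ (x ∷ p) (y ∷ q) t n = begin
  coeff n (((x + y) ∷ (p ⊕ q)) ⊗ t)
    ≡⟨ coeff-∷⊗ (x + y) (p ⊕ q) t n ⟩
  (x + y) * coeff n t + shift ⟦ (p ⊕ q) ⊗ t ⟧ n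
    ≡⟨ cong (_+_ ((x + y) * coeff n t))
         (trans (shift-cong (coeff-⊕⊗ p q t) n) (shift-+ ⟦ p ⊗ t ⟧ ⟦ q ⊗ t ⟧ n)) ⟩
  (x + y) * coeff n t + (shift ⟦ p ⊗ t ⟧ n + shift ⟦ q ⊗ t ⟧ n)
    ≡⟨ rearrange x y (coeff n t) _ _ ⟩
  (x * coeff n t + shift ⟦ p ⊗ t ⟧ n) + (y * coeff n t + shift ⟦ q ⊗ t ⟧ n)
    ≡⟨ sym (cong₂ _+_ (coeff-∷⊗ x p t n) (coeff-∷⊗ y q t n)) ⟩
  coeff n ((x ∷ p) ⊗ t) + coeff n ((y ∷ q) ⊗ t) ∎
  where
  rearrange : ∀ x y c u v → (x + y) * c + (u + v) ≡ (x * c + u) + (y * c + v)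
  rearrange = solve-∀

coeff-scale⊗ : ∀ c p t n → coeff n (map (c *_) p ⊗ t) ≡ c * coeff n (p ⊗ t)
coeff-scale⊗ c []      t n = sym (ℤₚ.*-zeroʳ c)
coeff-scale⊗ c (x ∷ p) t n = begin
  coeff n (map (c *_) (x ∷ p) ⊗ t)
    ≡⟨ coeff-∷⊗ (c * x) (map (c *_) p) t n ⟩
  c * x * coeff n t + shift ⟦ map (c *_) p ⊗ t ⟧ n
    ≡⟨ cong (_+_ (c * x * coeff n t))
         (trans (shift-cong (coeff-scale⊗ c p t) n) (shift-* c ⟦ p ⊗ t ⟧ n)) ⟩
  c * x * coeff n t + c * shift ⟦ p ⊗ t ⟧ n
    ≡⟨ factor c x (coeff n t) _ ⟩
  c * (x * coeff n t + shift ⟦ p ⊗ t ⟧ n)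
    ≡⟨ cong (c *_) (sym (coeff-∷⊗ x p t n)) ⟩
  c * coeff n ((x ∷ p) ⊗ t) ∎
  where
  factor : ∀ c x y u → c * x * y + c * u ≡ c * (x * y + u)
  factor = solve-∀

coeff-⊗-assoc : ∀ p q t n → coeff n ((p ⊗ q) ⊗ t) ≡ coeff n (p ⊗ (q ⊗ t))
coeff-⊗-assoc []      q t n = refl
coeff-⊗-assoc (x ∷ p) q t n = begin
  coeff n ((map (x *_) q ⊕ (+ 0 ∷ (p ⊗ q))) ⊗ t)
    ≡⟨ coeff-⊕⊗ (map (x *_) q) (+ 0 ∷ (p ⊗ q)) t n ⟩
  coeff n (map (x *_) q ⊗ t) + coeff n ((+ 0 ∷ (p ⊗ q)) ⊗ t)
    ≡⟨ cong₂ _+_ (coeff-scale⊗ x q t n) (coeff-∷⊗ (+ 0) (p ⊗ q) t n) ⟩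
  x * coeff n (q ⊗ t) + (+ 0 * coeff n t + shift ⟦ (p ⊗ q) ⊗ t ⟧ n)
    ≡⟨ cong (_+_ (x * coeff n (q ⊗ t)))
         (trans (ℤₚ.+-identityˡ _) (shift-cong (coeff-⊗-assoc p q t) n)) ⟩
  x * coeff n (q ⊗ t) + shift ⟦ p ⊗ (q ⊗ t) ⟧ n
    ≡⟨ sym (coeff-∷⊗ x p (q ⊗ t) n) ⟩
  coeff n ((x ∷ p) ⊗ (q ⊗ t)) ∎

coeff-oneMinusZ⊗ : ∀ t n → coeff n (oneMinusZ ⊗ t) ≡ Δ ⟦ t ⟧ n
coeff-oneMinusZ⊗ t zero = begin
  coeff 0 (oneMinusZ ⊗ t)         ≡⟨ coeff-∷⊗ (+ 1) (-1ℤ ∷ []) t 0 ⟩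
  + 1 * coeff 0 t + + 0           ≡⟨ ℤₚ.+-identityʳ _ ⟩
  + 1 * coeff 0 t                 ≡⟨ ℤₚ.*-identityˡ _ ⟩
  coeff 0 t                       ∎
coeff-oneMinusZ⊗ t (suc n) = begin
  coeff (suc n) (oneMinusZ ⊗ t)   ≡⟨ coeff-∷⊗ (+ 1) (-1ℤ ∷ []) t (suc n) ⟩
  + 1 * coeff (suc n) t + coeff n ((-1ℤ ∷ []) ⊗ t)
    ≡⟨ cong (_+_ (+ 1 * coeff (suc n) t)) (coeff-[x]⊗ -1ℤ t n) ⟩
  + 1 * coeff (suc n) t + -1ℤ * coeff n t ≡⟨ difference (coeff (suc n) t) (coeff n t) ⟩
  coeff (suc n) t - coeff n t     ∎
  where
  difference : ∀ u v → + 1 * u + -1ℤ * v ≡ u - v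
  difference = solve-∀

coeff-oneMinusZ^⊗ : ∀ r t n → coeff n ((oneMinusZ ^ᵖ r) ⊗ t) ≡ Δ^ r ⟦ t ⟧ n
coeff-oneMinusZ^⊗ zero    t n = trans (coeff-[x]⊗ (+ 1) t n) (ℤₚ.*-identityˡ _)
coeff-oneMinusZ^⊗ (suc r) t n = begin
  coeff n ((oneMinusZ ⊗ (oneMinusZ ^ᵖ r)) ⊗ t)   ≡⟨ coeff-⊗-assoc oneMinusZ (oneMinusZ ^ᵖ r) t n ⟩
  coeff n (oneMinusZ ⊗ ((oneMinusZ ^ᵖ r) ⊗ t))   ≡⟨ coeff-oneMinusZ⊗ ((oneMinusZ ^ᵖ r) ⊗ t) n ⟩
  Δ ⟦ (oneMinusZ ^ᵖ r) ⊗ t ⟧ n                   ≡⟨ Δ-cong (coeff-oneMinusZ^⊗ r t) n ⟩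
  Δ^ (suc r) ⟦ t ⟧ n                             ∎

DegreeAtMost : ℕ → Poly → Set
DegreeAtMost n p = ∀ i → n < i → coeff i p ≡ + 0

DegreeAtMost-tail : ∀ {n x p} → DegreeAtMost (suc n) (x ∷ p) → DegreeAtMost n p
DegreeAtMost-tail deg i = deg (suc i) ∘ s≤s

oneMinusZ^-degree : ∀ m → DegreeAtMost m (oneMinusZ ^ᵖ m)
oneMinusZ^-degree zero    (suc n) _         = refl
oneMinusZ^-degree (suc m) (suc n) (s≤s m<n) = begin
  coeff (suc n) (oneMinusZ ^ᵖ suc m)
    ≡⟨ coeff-oneMinusZ⊗ (oneMinusZ ^ᵖ m) (suc n) ⟩
  coeff (suc n) (oneMinusZ ^ᵖ m) - coeff n (oneMinusZ ^ᵖ m)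
    ≡⟨ cong₂ _-_ (oneMinusZ^-degree m (suc n) (ℕₚ.m≤n⇒m≤1+n m<n)) (oneMinusZ^-degree m n m<n) ⟩
  + 0 - + 0 ∎

oneMinusZ^-leading : ∀ m → coeff m (oneMinusZ ^ᵖ m) ≡ -1ℤ ^ m
oneMinusZ^-leading zero    = refl
oneMinusZ^-leading (suc m) = begin
  coeff (suc m) (oneMinusZ ^ᵖ suc m)
    ≡⟨ coeff-oneMinusZ⊗ (oneMinusZ ^ᵖ m) (suc m) ⟩
  coeff (suc m) (oneMinusZ ^ᵖ m) - coeff m (oneMinusZ ^ᵖ m)
    ≡⟨ cong₂ _-_ (oneMinusZ^-degree m (suc m) (ℕₚ.n<1+n m)) (oneMinusZ^-leading m) ⟩
  + 0 - -1ℤ ^ m     ≡⟨ negate (-1ℤ ^ m) ⟩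
  -1ℤ * -1ℤ ^ m     ∎
  where
  negate : ∀ s → + 0 - s ≡ -1ℤ * s
  negate = solve-∀

oneMinusZ^-subleading : ∀ m → shift ⟦ oneMinusZ ^ᵖ m ⟧ m ≡ -1ℤ ^ suc m * + m
oneMinusZ^-subleading zero    = refl
oneMinusZ^-subleading (suc m) = begin
  coeff m (oneMinusZ ^ᵖ suc m)
    ≡⟨ coeff-oneMinusZ⊗ (oneMinusZ ^ᵖ m) m ⟩
  Δ ⟦ oneMinusZ ^ᵖ m ⟧ m
    ≡⟨ Δ≡id-shift ⟦ oneMinusZ ^ᵖ m ⟧ m ⟩
  coeff m (oneMinusZ ^ᵖ m) - shift ⟦ oneMinusZ ^ᵖ m ⟧ m
    ≡⟨ cong₂ _-_ (oneMinusZ^-leading m) (oneMinusZ^-subleading m) ⟩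
  -1ℤ ^ m - -1ℤ * -1ℤ ^ m * + m
    ≡⟨ collect (-1ℤ ^ m) (+ m) ⟩
  -1ℤ * (-1ℤ * -1ℤ ^ m) * (+ 1 + + m) ∎
  where
  collect : ∀ s x → s - -1ℤ * s * x ≡ -1ℤ * (-1ℤ * s) * (+ 1 + x)
  collect = solve-∀

coeff-vanishing⊗ : ∀ p t → (∀ i → coeff i p ≡ + 0) → ∀ n → coeff n (p ⊗ t) ≡ + 0
coeff-vanishing⊗ []      t p≡0 n = refl
coeff-vanishing⊗ (x ∷ p) t p≡0 n = begin
  coeff n ((x ∷ p) ⊗ t)
    ≡⟨ coeff-∷⊗ x p t n ⟩
  x * coeff n t + shift ⟦ p ⊗ t ⟧ n
    ≡⟨ cong₂ _+_ (trans (cong (_* coeff n t) (p≡0 0)) (ℤₚ.*-zeroˡ (coeff n t)))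
                 (trans (shift-cong (coeff-vanishing⊗ p t (p≡0 ∘ suc)) n) (shift-zero n)) ⟩
  + 0 + + 0 ∎

coeff-degree0⊗ : ∀ p t → DegreeAtMost 0 p → ∀ n → coeff n (p ⊗ t) ≡ coeff 0 p * coeff n t
coeff-degree0⊗ []      t deg n = sym (ℤₚ.*-zeroˡ (coeff n t))
coeff-degree0⊗ (x ∷ p) t deg n = begin
  coeff n ((x ∷ p) ⊗ t)
    ≡⟨ coeff-∷⊗ x p t n ⟩
  x * coeff n t + shift ⟦ p ⊗ t ⟧ n
    ≡⟨ cong (_+_ (x * coeff n t)) (trans (shift-cong (coeff-vanishing⊗ p t p≡0) n) (shift-zero n)) ⟩
  x * coeff n t + + 0
    ≡⟨ ℤₚ.+-identityʳ _ ⟩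
  x * coeff n t ∎
  where
  p≡0 : ∀ i → coeff i p ≡ + 0
  p≡0 i = deg (suc i) (s≤s z≤n)

coeff-⊗-subleading : ∀ i j p q → DegreeAtMost (suc i) p → DegreeAtMost j q →
  coeff (i ℕ.+ j) (p ⊗ q) ≡ coeff i p * coeff j q + coeff (suc i) p * shift ⟦ q ⟧ j
coeff-⊗-subleading i j [] q _ _ = sym (zeros (coeff j q) (shift ⟦ q ⟧ j))
  where
  zeros : ∀ u v → + 0 * u + + 0 * v ≡ + 0
  zeros = solve-∀
coeff-⊗-subleading zero j (x ∷ p) q deg-p deg-q = begin
  coeff j ((x ∷ p) ⊗ q)
    ≡⟨ coeff-∷⊗ x p q j ⟩
  x * coeff j q + shift ⟦ p ⊗ q ⟧ j
    ≡⟨ cong (_+_ (x * coeff j q))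
            (trans (shift-cong (coeff-degree0⊗ p q (DegreeAtMost-tail deg-p)) j)
                   (shift-* (coeff 0 p) ⟦ q ⟧ j)) ⟩
  x * coeff j q + coeff 0 p * shift ⟦ q ⟧ j ∎
coeff-⊗-subleading (suc i) j (x ∷ p) q deg-p deg-q = begin
  coeff (suc i ℕ.+ j) ((x ∷ p) ⊗ q)
    ≡⟨ coeff-∷⊗ x p q (suc i ℕ.+ j) ⟩
  x * coeff (suc i ℕ.+ j) q + coeff (i ℕ.+ j) (p ⊗ q)
    ≡⟨ cong₂ _+_ (trans (cong (x *_) (deg-q _ (s≤s (ℕₚ.m≤n+m j i)))) (ℤₚ.*-zeroʳ x))
                 (coeff-⊗-subleading i j p q (DegreeAtMost-tail deg-p) deg-q) ⟩
  + 0 + (coeff i p * coeff j q + coeff (suc i) p * shift ⟦ q ⟧ j)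
    ≡⟨ ℤₚ.+-identityˡ _ ⟩
  coeff i p * coeff j q + coeff (suc i) p * shift ⟦ q ⟧ j ∎

Δ^-index-* : ∀ r s j →
  Δ^ (suc r) (λ n → + n * s n) j ≡ + j * Δ^ (suc r) s j + + suc r * shift (Δ^ r s) j
Δ^-index-* zero s zero = base (s 0)
  where
  base : ∀ u → + 0 * u ≡ + 0 * u + + 1 * + 0
  base = solve-∀
Δ^-index-* zero s (suc j) = step (+ j) (s (suc j)) (s j)
  where
  step : ∀ J u v → (+ 1 + J) * u - J * v ≡ (+ 1 + J) * (u - v) + + 1 * v
  step = solve-∀
Δ^-index-* (suc r) s zero = trans (Δ^-index-* r s zero) (base (Δ^ (suc r) s 0) (+ suc r) (+ suc (suc r)))
  where
  base : ∀ u x y → + 0 * u + x * + 0 ≡ + 0 * u + y * + 0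
  base = solve-∀
Δ^-index-* (suc r) s (suc j) = begin
  Δ^ (suc r) X (suc j) - Δ^ (suc r) X j
    ≡⟨ cong₂ _-_ (Δ^-index-* r s (suc j)) (Δ^-index-* r s j) ⟩
  (+ suc j * A (suc j) + + suc r * B j) - (+ j * A j + + suc r * shift B j)
    ≡⟨ cong (λ u → (+ suc j * A (suc j) + + suc r * B j) - (+ j * u + + suc r * shift B j))
            (Δ≡id-shift B j) ⟩
  (+ suc j * A (suc j) + + suc r * B j) - (+ j * (B j - shift B j) + + suc r * shift B j)
    ≡⟨ regroup (+ j) (+ r) (A (suc j)) (B j) (shift B j) ⟩
  + suc j * (A (suc j) - (B j - shift B j)) + + suc (suc r) * (B j - shift B j)
    ≡⟨ cong (λ u → + suc j * (A (suc j) - u) + + suc (suc r) * u) (sym (Δ≡id-shift B j)) ⟩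
  + suc j * Δ A (suc j) + + suc (suc r) * shift A (suc j) ∎
  where
  X : Seq
  X n = + n * s n
  A B : Seq
  A = Δ^ (suc r) s
  B = Δ^ r s
  regroup : ∀ J R a b z → ((+ 1 + J) * a + (+ 1 + R) * b) - (J * (b - z) + (+ 1 + R) * z)
                          ≡ (+ 1 + J) * (a - (b - z)) + (+ 1 + (+ 1 + R)) * (b - z)
  regroup = solve-∀

powers : ℕ → Seq
powers k n = + (n ^ℕ k)

eulerian : ℕ → Seq
eulerian k = Δ^ (suc k) (powers k)

eulerian-suc : ∀ k j →
  eulerian (suc k) j ≡ + j * Δ (eulerian k) j + + suc (suc k) * shift (eulerian k) j
eulerian-suc k j = trans (Δ^-local (suc (suc k)) j (λ n _ → ℤₚ.pos-* n (n ^ℕ k)))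
                         (Δ^-index-* (suc k) (powers k) j)

eulerian-vanishes : ∀ k j → k < j → eulerian k j ≡ + 0
eulerian-vanishes zero    (suc j) _         = refl
eulerian-vanishes (suc k) (suc j) (s≤s k<j) = begin
  eulerian (suc k) (suc j)
    ≡⟨ eulerian-suc k (suc j) ⟩
  + suc j * (eulerian k (suc j) - eulerian k j) + + suc (suc k) * eulerian k j
    ≡⟨ cong₂ (λ u v → + suc j * (u - v) + + suc (suc k) * v)
             (eulerian-vanishes k (suc j) (ℕₚ.m≤n⇒m≤1+n k<j)) (eulerian-vanishes k j k<j) ⟩
  + suc j * (+ 0 - + 0) + + suc (suc k) * + 0
    ≡⟨ zeros (+ suc j) (+ suc (suc k)) ⟩
  + 0 ∎
  where
  zeros : ∀ x y → x * (+ 0 - + 0) + y * + 0 ≡ + 0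
  zeros = solve-∀

eulerian-leading : ∀ k → eulerian k k ≡ + 1
eulerian-leading zero    = refl
eulerian-leading (suc k) = begin
  eulerian (suc k) (suc k)
    ≡⟨ eulerian-suc k (suc k) ⟩
  + suc k * (eulerian k (suc k) - eulerian k k) + + suc (suc k) * eulerian k k
    ≡⟨ cong₂ (λ u v → + suc k * (u - v) + + suc (suc k) * v)
             (eulerian-vanishes k (suc k) (ℕₚ.n<1+n k)) (eulerian-leading k) ⟩
  + suc k * (+ 0 - + 1) + + suc (suc k) * + 1
    ≡⟨ collapse (+ k) ⟩
  + 1 ∎
  where
  collapse : ∀ x → (+ 1 + x) * (+ 0 - + 1) + (+ 1 + (+ 1 + x)) * + 1 ≡ + 1
  collapse = solve-∀

eulerian-subleading : ∀ k → eulerian (suc k) k ≡ + (2 ^ℕ suc k) - + 1 - + suc k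
eulerian-subleading zero    = refl
eulerian-subleading (suc k) = begin
  eulerian (suc (suc k)) (suc k)
    ≡⟨ eulerian-suc (suc k) (suc k) ⟩
  + suc k * (eulerian (suc k) (suc k) - eulerian (suc k) k) + + suc (suc (suc k)) * eulerian (suc k) k
    ≡⟨ cong₂ (λ u v → + suc k * (u - v) + + suc (suc (suc k)) * v)
             (eulerian-leading (suc k)) (eulerian-subleading k) ⟩
  + suc k * (+ 1 - E) + + suc (suc (suc k)) * E
    ≡⟨ simplify (+ k) (+ (2 ^ℕ suc k)) ⟩
  + 2 * + (2 ^ℕ suc k) - + 1 - + suc (suc k)
    ≡⟨ cong (λ x → x - + 1 - + suc (suc k)) (sym (ℤₚ.pos-* 2 (2 ^ℕ suc k))) ⟩
  + (2 ^ℕ suc (suc k)) - + 1 - + suc (suc k) ∎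
  where
  E : ℤ
  E = + (2 ^ℕ suc k) - + 1 - + suc k
  simplify : ∀ x p → (+ 1 + x) * (+ 1 - (p - + 1 - (+ 1 + x)))
                       + (+ 1 + (+ 1 + (+ 1 + x))) * (p - + 1 - (+ 1 + x))
                     ≡ + 2 * p - + 1 - (+ 1 + (+ 1 + x))
  simplify = solve-∀

coeff-take-< : ∀ n p j → j < n → coeff j (take n p) ≡ coeff j p
coeff-take-< (suc n) []      j       _         = refl
coeff-take-< (suc n) (x ∷ p) zero    _         = refl
coeff-take-< (suc n) (x ∷ p) (suc j) (s≤s j<n) = coeff-take-< n p j j<n

coeff-take-≥ : ∀ n p j → n ≤ j → coeff j (take n p) ≡ + 0
coeff-take-≥ zero    p       j       _         = refl
coeff-take-≥ (suc n) []      j       _         = refl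
coeff-take-≥ (suc n) (x ∷ p) (suc j) (s≤s n≤j) = coeff-take-≥ n p j n≤j

coeff-map-applyUpTo : ∀ (f : ℕ → ℤ) g n i → i < n → coeff i (map f (applyUpTo g n)) ≡ f (g i)
coeff-map-applyUpTo f g (suc n) zero    _         = refl
coeff-map-applyUpTo f g (suc n) (suc i) (s≤s i<n) = coeff-map-applyUpTo f (g ∘ suc) n i i<n

φ-degree : ∀ k → DegreeAtMost k (φ k)
φ-degree k i = coeff-take-≥ (suc k) ((oneMinusZ ^ᵖ suc k) ⊗ seriesTrunc k) i

a≡eulerian : ∀ k j → j ≤ k → a k j ≡ eulerian k j
a≡eulerian k j j≤k = begin
  coeff j (take (suc k) ((oneMinusZ ^ᵖ suc k) ⊗ seriesTrunc k))
    ≡⟨ coeff-take-< (suc k) ((oneMinusZ ^ᵖ suc k) ⊗ seriesTrunc k) j (s≤s j≤k) ⟩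
  coeff j ((oneMinusZ ^ᵖ suc k) ⊗ seriesTrunc k)
    ≡⟨ coeff-oneMinusZ^⊗ (suc k) (seriesTrunc k) j ⟩
  Δ^ (suc k) ⟦ seriesTrunc k ⟧ j
    ≡⟨ Δ^-local (suc k) j (λ i i≤j →
         coeff-map-applyUpTo (powers k) id (suc k) i (s≤s (ℕₚ.≤-trans i≤j j≤k))) ⟩
  eulerian k j ∎

a-leading : ∀ k → a k k ≡ + 1
a-leading k = trans (a≡eulerian k k ℕₚ.≤-refl) (eulerian-leading k)

a-subleading : ∀ k → a (suc k) k ≡ + (2 ^ℕ suc k) - + 1 - + suc k
a-subleading k = trans (a≡eulerian (suc k) k (ℕₚ.n≤1+n k)) (eulerian-subleading k)

coeffL-⊕ᴸ : ∀ {d} (p q : PolyL d) j l → coeffL j (p ⊕ᴸ q) l ≡ coeffL j p l + coeffL j q l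
coeffL-⊕ᴸ []      q       j       l = sym (ℤₚ.+-identityˡ _)
coeffL-⊕ᴸ (u ∷ p) []      j       l = sym (ℤₚ.+-identityʳ _)
coeffL-⊕ᴸ (u ∷ p) (v ∷ q) zero    l = refl
coeffL-⊕ᴸ (u ∷ p) (v ∷ q) (suc j) l = coeffL-⊕ᴸ p q j l

coeffL-·ᴸ : ∀ {d} p (v : Form d) j l → coeffL j (p ·ᴸ v) l ≡ coeff j p * v l
coeffL-·ᴸ []      v j       l = sym (ℤₚ.*-zeroˡ (v l))
coeffL-·ᴸ (x ∷ p) v zero    l = refl
coeffL-·ᴸ (x ∷ p) v (suc j) l = coeffL-·ᴸ p v j l

unitForm-≡ : ∀ {d} (i l : Fin (suc d)) → toℕ i ≡ toℕ l → unitForm i l ≡ + 1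
unitForm-≡ i l i≡l with i Fin.≟ l
... | yes _   = refl
... | no  i≢l = contradiction (Finₚ.toℕ-injective i≡l) i≢l

unitForm-≢ : ∀ {d} (i l : Fin (suc d)) → toℕ i ≢ toℕ l → unitForm i l ≡ + 0
unitForm-≢ i l i≢l with i Fin.≟ l
... | yes i≡l = contradiction (cong toℕ i≡l) i≢l
... | no  _   = refl

summand : ℕ → ℕ → Poly
summand d i = φ i ⊗ (oneMinusZ ^ᵖ (d ∸ i))

IndexPreserving : ∀ {m d} → (Fin m → Fin d) → Set
IndexPreserving ι = ∀ i → toℕ (ι i) ≡ toℕ i

coeffL-sumTerms-suc : ∀ {d} m (ι : Fin (suc m) → Fin d) j l →
  coeffL j (sumTerms d (suc m) ι) l
    ≡ coeffL j (sumTerms d m (ι ∘ inject₁)) l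
      + coeff j (summand d (suc m)) * unitForm (Fin.suc (ι (fromℕ m))) l
coeffL-sumTerms-suc {d} m ι j l =
  trans (coeffL-⊕ᴸ (sumTerms d m (ι ∘ inject₁)) (summand d (suc m) ·ᴸ new) j l)
        (cong (_+_ (coeffL j (sumTerms d m (ι ∘ inject₁)) l)) (coeffL-·ᴸ (summand d (suc m)) new j l))
  where
  new : Form d
  new = unitForm (Fin.suc (ι (fromℕ m)))

module _ {d m} {ι : Fin (suc m) → Fin d} (ι-pres : IndexPreserving ι) where

  IndexPreserving-inject₁ : IndexPreserving (ι ∘ inject₁)
  IndexPreserving-inject₁ i = trans (ι-pres (inject₁ i)) (Finₚ.toℕ-inject₁ i)

  toℕ-last : toℕ (Fin.suc (ι (fromℕ m))) ≡ suc m
  toℕ-last = cong suc (trans (ι-pres (fromℕ m)) (Finₚ.toℕ-fromℕ m))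

coeffL-sumTerms-outside : ∀ {d} m (ι : Fin m → Fin d) → IndexPreserving ι →
  ∀ j l → m < toℕ l → coeffL j (sumTerms d m ι) l ≡ + 0
coeffL-sumTerms-outside zero    ι ι-pres j l _   = refl
coeffL-sumTerms-outside {d} (suc m) ι ι-pres j l m<l = begin
  coeffL j (sumTerms d (suc m) ι) l  ≡⟨ coeffL-sumTerms-suc m ι j l ⟩
  rest + c * unitForm last l         ≡⟨ cong₂ (λ u v → u + c * v) earlier-vanish (unitForm-≢ last l last≢l) ⟩
  + 0 + c * + 0                      ≡⟨ trans (ℤₚ.+-identityˡ _) (ℤₚ.*-zeroʳ c) ⟩
  + 0                                ∎
  where
  c : ℤ
  c = coeff j (summand d (suc m))
  rest : ℤ
  rest = coeffL j (sumTerms d m (ι ∘ inject₁)) l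
  last : Fin (suc d)
  last = Fin.suc (ι (fromℕ m))
  earlier-vanish : rest ≡ + 0
  earlier-vanish = coeffL-sumTerms-outside m (ι ∘ inject₁) (IndexPreserving-inject₁ ι-pres) j l
                     (ℕₚ.<-trans (ℕₚ.n<1+n m) m<l)
  last≢l : toℕ last ≢ toℕ l
  last≢l e = ℕₚ.<-irrefl (trans (sym (toℕ-last ι-pres)) e) m<l

coeffL-sumTerms-inside : ∀ {d} m (ι : Fin m → Fin d) → IndexPreserving ι →
  ∀ {k} j l → toℕ l ≡ suc k → k < m → coeffL j (sumTerms d m ι) l ≡ coeff j (summand d (suc k))
coeffL-sumTerms-inside {d} (suc m) ι ι-pres {k} j l l≡1+k (s≤s k≤m)
  with ℕₚ.m≤n⇒m<n∨m≡n k≤m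
... | inj₁ k<m = begin
  coeffL j (sumTerms d (suc m) ι) l  ≡⟨ coeffL-sumTerms-suc m ι j l ⟩
  rest + c * unitForm last l         ≡⟨ cong₂ (λ u v → u + c * v) earlier (unitForm-≢ last l last≢l) ⟩
  coeff j (summand d (suc k)) + c * + 0
    ≡⟨ trans (cong (_+_ (coeff j (summand d (suc k)))) (ℤₚ.*-zeroʳ c)) (ℤₚ.+-identityʳ _) ⟩
  coeff j (summand d (suc k))        ∎
  where
  c : ℤ
  c = coeff j (summand d (suc m))
  rest : ℤ
  rest = coeffL j (sumTerms d m (ι ∘ inject₁)) l
  last : Fin (suc d)
  last = Fin.suc (ι (fromℕ m))
  earlier : rest ≡ coeff j (summand d (suc k))
  earlier = coeffL-sumTerms-inside m (ι ∘ inject₁) (IndexPreserving-inject₁ ι-pres) j l l≡1+k k<m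
  last≢l : toℕ last ≢ toℕ l
  last≢l e = ℕₚ.<-irrefl (trans (sym l≡1+k) (trans (sym e) (toℕ-last ι-pres))) (s≤s k<m)
... | inj₂ refl = begin
  coeffL j (sumTerms d (suc m) ι) l  ≡⟨ coeffL-sumTerms-suc m ι j l ⟩
  rest + c * unitForm last l         ≡⟨ cong₂ (λ u v → u + c * v) earlier-vanish (unitForm-≡ last l last≡l) ⟩
  + 0 + c * + 1                      ≡⟨ trans (ℤₚ.+-identityˡ _) (ℤₚ.*-identityʳ c) ⟩
  c                                  ∎
  where
  c : ℤ
  c = coeff j (summand d (suc m))
  rest : ℤ
  rest = coeffL j (sumTerms d m (ι ∘ inject₁)) l
  last : Fin (suc d)
  last = Fin.suc (ι (fromℕ m))
  earlier-vanish : rest ≡ + 0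
  earlier-vanish = coeffL-sumTerms-outside m (ι ∘ inject₁) (IndexPreserving-inject₁ ι-pres) j l
                     (subst (m <_) (sym l≡1+k) (ℕₚ.n<1+n m))
  last≡l : toℕ last ≡ toℕ l
  last≡l = trans (toℕ-last ι-pres) (sym l≡1+k)

hstar≡coeff-summand : ∀ {k} d j (l : Fin (suc d)) → toℕ l ≡ suc k →
  hstar d j l ≡ coeff j (summand d (suc k))
hstar≡coeff-summand {k} d j l l≡1+k = begin
  coeffL j (((oneMinusZ ^ᵖ d) ·ᴸ unitForm Fin.zero) ⊕ᴸ sumTerms d d id) l
    ≡⟨ coeffL-⊕ᴸ ((oneMinusZ ^ᵖ d) ·ᴸ unitForm Fin.zero) (sumTerms d d id) j l ⟩
  coeffL j ((oneMinusZ ^ᵖ d) ·ᴸ unitForm Fin.zero) l + coeffL j (sumTerms d d id) l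
    ≡⟨ cong₂ _+_ constant-part (coeffL-sumTerms-inside d id (λ _ → refl) j l l≡1+k k<d) ⟩
  + 0 + coeff j (summand d (suc k))
    ≡⟨ ℤₚ.+-identityˡ _ ⟩
  coeff j (summand d (suc k)) ∎
  where
  k<d : k < d
  k<d = subst (_≤ d) l≡1+k (Finₚ.toℕ≤pred[n] l)
  constant-part : coeffL j ((oneMinusZ ^ᵖ d) ·ᴸ unitForm Fin.zero) l ≡ + 0
  constant-part = begin
    coeffL j ((oneMinusZ ^ᵖ d) ·ᴸ unitForm Fin.zero) l
      ≡⟨ coeffL-·ᴸ (oneMinusZ ^ᵖ d) (unitForm Fin.zero) j l ⟩
    coeff j (oneMinusZ ^ᵖ d) * unitForm Fin.zero l
      ≡⟨ cong (coeff j (oneMinusZ ^ᵖ d) *_) (unitForm-≢ Fin.zero l (λ e → ℕₚ.0≢1+n (trans e l≡1+k))) ⟩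
    coeff j (oneMinusZ ^ᵖ d) * + 0
      ≡⟨ ℤₚ.*-zeroʳ (coeff j (oneMinusZ ^ᵖ d)) ⟩
    + 0 ∎

coeff-summand-subleading : ∀ k m →
  coeff (k ℕ.+ m) (summand (suc k ℕ.+ m) (suc k)) ≡ -1ℤ ^ m * (a (suc k) k - + m)
coeff-summand-subleading k m = begin
  coeff (k ℕ.+ m) (φ (suc k) ⊗ (oneMinusZ ^ᵖ (k ℕ.+ m ∸ k)))
    ≡⟨ cong (λ e → coeff (k ℕ.+ m) (φ (suc k) ⊗ (oneMinusZ ^ᵖ e))) (ℕₚ.m+n∸m≡n k m) ⟩
  coeff (k ℕ.+ m) (φ (suc k) ⊗ (oneMinusZ ^ᵖ m))
    ≡⟨ coeff-⊗-subleading k m (φ (suc k)) (oneMinusZ ^ᵖ m) (φ-degree (suc k)) (oneMinusZ^-degree m) ⟩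
  a (suc k) k * coeff m (oneMinusZ ^ᵖ m) + a (suc k) (suc k) * shift ⟦ oneMinusZ ^ᵖ m ⟧ m
    ≡⟨ cong₂ (λ u v → a (suc k) k * u + v)
             (oneMinusZ^-leading m)
             (cong₂ _*_ (a-leading (suc k)) (oneMinusZ^-subleading m)) ⟩
  a (suc k) k * -1ℤ ^ m + + 1 * (-1ℤ * -1ℤ ^ m * + m)
    ≡⟨ factor (a (suc k) k) (-1ℤ ^ m) (+ m) ⟩
  -1ℤ ^ m * (a (suc k) k - + m) ∎
  where
  factor : ∀ x s y → x * s + + 1 * (-1ℤ * s * y) ≡ s * (x - y)
  factor = solve-∀

hstar-subleading : ∀ k m (l : Fin (suc (suc k ℕ.+ m))) → toℕ l ≡ suc k →
  hstar (suc k ℕ.+ m) (k ℕ.+ m) l ≡ -1ℤ ^ m * (a (suc k) k - + m)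
hstar-subleading k m l l≡1+k =
  trans (hstar≡coeff-summand (suc k ℕ.+ m) (k ℕ.+ m) l l≡1+k) (coeff-summand-subleading k m)

-1ℤ^[q*2+n]≡-1ℤ^n : ∀ q n → -1ℤ ^ (q ℕ.* 2 ℕ.+ n) ≡ -1ℤ ^ n
-1ℤ^[q*2+n]≡-1ℤ^n zero    n = refl
-1ℤ^[q*2+n]≡-1ℤ^n (suc q) n = trans (cancel (-1ℤ ^ (q ℕ.* 2 ℕ.+ n))) (-1ℤ^[q*2+n]≡-1ℤ^n q n)
  where
  cancel : ∀ s → -1ℤ * (-1ℤ * s) ≡ s
  cancel = solve-∀

odd⇒≡1+q*2 : ∀ {k} → k % 2 ≡ 1 → ∃ λ q → k ≡ suc (q ℕ.* 2)
odd⇒≡1+q*2 {k} k-odd = k / 2 , trans (m≡m%n+[m/n]*n k 2) (cong (ℕ._+ (k / 2) ℕ.* 2) k-odd)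

proposition3 : (k d : ℕ) → k % 2 ≡ 1 → 1 ≤ k → (hk : k ≤ d) →
    (hstar d (d ∸ 1) (fromℕ< (s≤s hk))
       ≡ (-[1+ 0 ] ^ suc d) * (a k (k ∸ 1) - (+ d - + k)))
    × (hstar d (d ∸ 1) (fromℕ< (s≤s hk))
       ≡ (-[1+ 0 ] ^ suc d) * (+ (2 ^ℕ k) - + 1 - + d))
proposition3 k d k-odd _ hk
  with q , refl ← odd⇒≡1+q*2 {k} k-odd
  with m , refl ← ℕₚ.m≤n⇒∃[o]m+o≡n hk
  = h*≡ , trans h*≡ (trans (cong (λ x → -1ℤ ^ suc d * (x - (+ d - + k))) (a-subleading (q ℕ.* 2)))
                           (cancel (-1ℤ ^ suc d) (+ (2 ^ℕ k)) (+ k) (+ d)))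
  where
  cancel : ∀ s p k d → s * ((p - + 1 - k) - (d - k)) ≡ s * (p - + 1 - d)
  cancel = solve-∀
  d-k≡m : + d - + k ≡ + m
  d-k≡m = trans (cong (_- + k) (ℤₚ.pos-+ k m)) (drop (+ k) (+ m))
    where
    drop : ∀ x y → x + y - x ≡ y
    drop = solve-∀
  h*≡ : hstar d (d ∸ 1) (fromℕ< (s≤s hk)) ≡ -1ℤ ^ suc d * (a k (k ∸ 1) - (+ d - + k))
  h*≡ = begin
    hstar d (d ∸ 1) (fromℕ< (s≤s hk))
      ≡⟨ hstar-subleading (q ℕ.* 2) m (fromℕ< (s≤s hk)) (Finₚ.toℕ-fromℕ< (s≤s hk)) ⟩
    -1ℤ ^ m * (a k (q ℕ.* 2) - + m)
      ≡⟨ cong₂ (λ s x → s * (a k (q ℕ.* 2) - x)) (sym (-1ℤ^[q*2+n]≡-1ℤ^n (suc q) m)) (sym d-k≡m) ⟩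
    -1ℤ ^ suc d * (a k (k ∸ 1) - (+ d - + k)) ∎
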